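{- For integers $n,m\geq 3$, $\dim_s(K_{n,n}^{ -M}\diamond K_{m,m}^{ -M})=3nm$.
   Context: $K_{n,n}^{ -M}$ is the complete bipartite graph $K_{n,n}$ minus a perfect matching. The modular product $G\diamond H$ has vertex set $V(G)\times V(H)$, and $(g,h)$, $(g',h')$ are adjacent if $g=g'$ and $hh'\in E(H)$, or $gg'\in E(G)$ and $h=h'$, or $gg'\in E(G)$ and $hh'\in E(H)$, or ($g\neq g'$, $h\neq h'$, $gg'\notin E(G)$ and $hh'\notin E(H)$). $\dim_s(X)$ is the strong metric dimension: the minimum size of $S\subseteq V(X)$ such that for all distinct $x,y$ some $z\in S$ satisfies $d_X(y,z)=d_X(y,x)+d_X(x,z)$ or $d_X(x,z)=d_X(x,y)+d_X(y,z)$. -}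

module Defs where

open import Level using (0ℓ)
open import Data.Nat using (ℕ; zero; suc; _+_; _*_; _<_; _≤_)
open import Data.Fin using (Fin)
open import Data.Bool using (Bool)
open import Data.Product using (_×_; _,_; ∃; ∃-syntax; Σ-syntax)
open import Data.Sum using (_⊎_)
open import Data.List using (List; length)
open import Data.List.Membership.Propositional using (_∈_)
open import Data.List.Relation.Unary.Unique.Propositional using (Unique)
open import Relation.Binary.PropositionalEquality using (_≡_; _≢_)
open import Relation.Nullary using (¬_)

record Graph : Set₁ where
  field
    Vertex : Set
    Adj    : Vertex → Vertex → Set
open Graph public

data Walk (G : Graph) : Vertex G → Vertex G → ℕ → Set where
  here  : ∀ {x} → Walk G x x zero
  step  : ∀ {x y z k} → Adj G x y → Walk G y z k → Walk G x z (suc k)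

Dist : (G : Graph) → Vertex G → Vertex G → ℕ → Set
Dist G x y d = Walk G x y d × (∀ j → j < d → ¬ Walk G x y j)

StronglyResolves : (G : Graph) → Vertex G → Vertex G → Vertex G → Set
StronglyResolves G z x y =
  (∃[ a ] ∃[ b ] ∃[ c ] (Dist G y z a × Dist G y x b × Dist G x z c × a ≡ b + c))
  ⊎ (∃[ a ] ∃[ b ] ∃[ c ] (Dist G x z a × Dist G x y b × Dist G y z c × a ≡ b + c))

StrongResolving : (G : Graph) → List (Vertex G) → Set
StrongResolving G S =
  ∀ x y → x ≢ y → ∃[ z ] (z ∈ S × StronglyResolves G z x y)

StrongMetricDim : Graph → ℕ → Set
StrongMetricDim G k =
  (∃[ S ] (Unique S × length S ≡ k × StrongResolving G S))
  × (∀ (S : List (Vertex G)) → Unique S → StrongResolving G S → k ≤ length S)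

-- K_{n,n} minus a perfect matching: vertices (i , side), i : Fin n;
-- (i , a) ~ (j , b) iff a ≠ b and i ≠ j  (the matching is {(i,false),(i,true)}).
KnnMinusM : ℕ → Graph
KnnMinusM n = record
  { Vertex = Fin n × Bool
  ; Adj    = λ { (i , a) (j , b) → a ≢ b × i ≢ j } }

_◇_ : Graph → Graph → Graph
G ◇ H = record
  { Vertex = Vertex G × Vertex H
  ; Adj    = λ { (g , h) (g' , h') →
        (g ≡ g' × Adj H h h')
      ⊎ (Adj G g g' × h ≡ h')
      ⊎ (Adj G g g' × Adj H h h')
      ⊎ (g ≢ g' × h ≢ h' × ¬ Adj G g g' × ¬ Adj H h h') } }

-- The vertices ((i , a) , (j , b)) of K_{n,n}^{-M} ◇ K_{m,m}^{-M} with fixed i, j form a block of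
-- four. In K_{n,n}^{-M} every vertex is equal or adjacent to exactly one end of each removed
-- matching edge; in the product this makes two vertices of a block that differ in one side
-- diametral (at distance 3, the diameter), and two that differ in both sides twins. Either way
-- the pair is mutually maximally distant, so only its own ends strongly resolve it: a strong
-- resolving set meets every pair of every block, hence contains 3 of the 4 vertices of each of
-- the nm blocks. Conversely the 3nm vertices with (a , b) ≠ (false , false) strongly resolve every
-- pair containing one of them, and each pair of two remaining vertices is resolved by a suitably
-- chosen one of the 3nm.
module Submission where

open import Defs
open import Data.Bool using (Bool; true; false; not) renaming (_≟_ to _≟ᵇ_)
open import Data.Bool.Properties using (not-¬)
open import Data.Empty using (⊥-elim)
open import Data.Fin using (Fin; zero; suc) renaming (_≟_ to _≟ᶠ_)
open import Data.List
  using (List; []; _∷_; _++_; length; concatMap; filter; allFin; cartesianProduct; map)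
open import Data.List.Properties using (length-++; length-map; length-tabulate; filter-all)
open import Data.List.Membership.Propositional using (_∈_; find; lose)
open import Data.List.Membership.Propositional.Properties
  using (∈-∃++; ∈-++⁻; ∈-++⁺ˡ; ∈-++⁺ʳ; ∈-concatMap⁺; ∈-concatMap⁻; ∈-cartesianProduct⁺;
         ∈-allFin; ∈-filter⁻)
open import Data.List.Relation.Binary.Disjoint.Propositional using (Disjoint)
open import Data.List.Relation.Binary.Subset.Propositional using (_⊆_)
open import Data.List.Relation.Unary.All as All using ([]; _∷_)
open import Data.List.Relation.Unary.AllPairs as AllPairs using (AllPairs; []; _∷_)
open import Data.List.Relation.Unary.Any using (Any; here; there; satisfied; any?)
open import Data.List.Relation.Unary.Unique.Propositional using (Unique)
open import Data.List.Relation.Unary.Unique.Propositional.Properties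
  using (++⁺; filter⁺; cartesianProduct⁺; allFin⁺)
open import Data.Nat using (ℕ; zero; suc; _+_; _*_; _<_; _≤_; z≤n; s≤s; s≤s⁻¹)
open import Data.Nat.Properties
  using (≤-refl; ≤-trans; ≤-reflexive; n≤1+n; m≤n+m; ≮⇒≥; ≤∧≮⇒≡; m<1+n⇒m<n∨m≡n; m+1+n≰m;
         +-mono-≤; +-suc; +-identityʳ; *-comm; *-assoc; module ≤-Reasoning)
open import Data.Product using (_×_; _,_; proj₁; proj₂; ∃; ∃-syntax; ∃₂)
open import Data.Product.Properties using (≡-dec)
open import Data.Sum using (_⊎_; inj₁; inj₂; [_,_]′)
open import Function using (_∘_; id)
open import Relation.Binary using (Decidable; DecidableEquality; Irreflexive; Symmetric)
open import Relation.Binary.PropositionalEquality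
open import Relation.Nullary using (¬_; ¬?; Dec; yes; no; contradiction; _×-dec_; _⊎-dec_)
open import Relation.Nullary.Decidable using (map′)

Least : (ℕ → Set) → ℕ → Set
Least P d = P d × (∀ j → j < d → ¬ P j)

least : {P : ℕ → Set} → (∀ k → Dec (P k)) → ∀ {k} → P k → ∃ (Least P)
least {P} P? {k} = search 0 k (λ _ ())
  where
  search : ∀ i fuel → (∀ j → j < i → ¬ P j) → P (i + fuel) → ∃ (Least P)
  search i zero below p = i , subst P (+-identityʳ i) p , below
  search i (suc fuel) below p with P? i
  ... | yes pᵢ = i , pᵢ , below
  ... | no ¬pᵢ = search (suc i) fuel below′ (subst P (+-suc i fuel) p)
    where
    below′ : ∀ j → j < suc i → ¬ P j
    below′ j j<1+i = [ below j , (λ { refl → ¬pᵢ }) ]′ (m<1+n⇒m<n∨m≡n j<1+i)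

module _ {A : Set} where

  Unique⇒length≤ : {xs ys : List A} → Unique xs → xs ⊆ ys → length xs ≤ length ys
  Unique⇒length≤ {[]} _ _ = z≤n
  Unique⇒length≤ {x ∷ xs} {ys} (x∉xs ∷ xs-unique) xs⊆ys with ∈-∃++ (xs⊆ys (here refl))
  ... | bs , cs , refl =
    ≤-trans (s≤s (Unique⇒length≤ xs-unique xs⊆bs++cs)) (≤-reflexive (sym length-insert))
    where
    xs⊆bs++cs : xs ⊆ bs ++ cs
    xs⊆bs++cs v∈xs with ∈-++⁻ bs (xs⊆ys (there v∈xs))
    ... | inj₁ v∈bs = ∈-++⁺ˡ v∈bs
    ... | inj₂ (here refl) = contradiction refl (All.lookup x∉xs v∈xs)
    ... | inj₂ (there v∈cs) = ∈-++⁺ʳ bs v∈cs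
    length-insert : length (bs ++ x ∷ cs) ≡ suc (length (bs ++ cs))
    length-insert = begin
      length (bs ++ x ∷ cs)          ≡⟨ length-++ bs ⟩
      length bs + suc (length cs)    ≡⟨ +-suc (length bs) (length cs) ⟩
      suc (length bs + length cs)    ≡⟨ cong suc (length-++ bs) ⟨
      suc (length (bs ++ cs))        ∎
      where open ≡-Reasoning

  length-filter-pairwiseCover : {P : A → Set} (P? : ∀ x → Dec (P x)) {xs : List A} →
    AllPairs (λ x y → P x ⊎ P y) xs → length xs ≤ suc (length (filter P? xs))
  length-filter-pairwiseCover P? [] = z≤n
  length-filter-pairwiseCover {P} P? {x ∷ xs} (x-covers ∷ covers) with P? x
  ... | yes _ = s≤s (length-filter-pairwiseCover P? covers)
  ... | no ¬px = s≤s (≤-reflexive (cong length (sym (filter-all P? (All.map covered x-covers)))))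
    where
    covered : ∀ {y} → P x ⊎ P y → P y
    covered (inj₁ px) = contradiction px ¬px
    covered (inj₂ py) = py

module _ {A B : Set} where

  unique-concatMap : (key : B → A) {f : A → List B} {xs : List A} →
    Unique xs → (∀ x → Unique (f x)) → (∀ {x y} → y ∈ f x → key y ≡ x) →
    Unique (concatMap f xs)
  unique-concatMap key {xs = []} [] _ _ = []
  unique-concatMap key {f} {x ∷ xs} (x∉xs ∷ xs-unique) f-unique keyed =
    ++⁺ (f-unique x) (unique-concatMap key xs-unique f-unique keyed) disjoint
    where
    disjoint : Disjoint (f x) (concatMap f xs)
    disjoint (y∈fx , y∈rest) with find (∈-concatMap⁻ f {xs = xs} y∈rest)
    ... | x′ , x′∈xs , y∈fx′ = All.lookup x∉xs x′∈xs (trans (sym (keyed y∈fx)) (keyed y∈fx′))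

  length-concatMap-≥ : (f : A → List B) {c : ℕ} (xs : List A) → (∀ x → c ≤ length (f x)) →
    length xs * c ≤ length (concatMap f xs)
  length-concatMap-≥ f [] _ = z≤n
  length-concatMap-≥ f (x ∷ xs) c≤ =
    ≤-trans (+-mono-≤ (c≤ x) (length-concatMap-≥ f xs c≤)) (≤-reflexive (sym (length-++ (f x))))

  length-concatMap-≡ : (f : A → List B) {c : ℕ} (xs : List A) → (∀ x → length (f x) ≡ c) →
    length (concatMap f xs) ≡ length xs * c
  length-concatMap-≡ f [] _ = refl
  length-concatMap-≡ f (x ∷ xs) c≡ =
    trans (length-++ (f x)) (cong₂ _+_ (c≡ x) (length-concatMap-≡ f xs c≡))

  length-cartesianProduct : (xs : List A) (ys : List B) →
    length (cartesianProduct xs ys) ≡ length xs * length ys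
  length-cartesianProduct [] ys = refl
  length-cartesianProduct (x ∷ xs) ys = begin
    length (map (x ,_) ys ++ cartesianProduct xs ys)
      ≡⟨ length-++ (map (x ,_) ys) ⟩
    length (map (x ,_) ys) + length (cartesianProduct xs ys)
      ≡⟨ cong₂ _+_ (length-map (x ,_) ys) (length-cartesianProduct xs ys) ⟩
    length ys + length xs * length ys
      ∎
    where open ≡-Reasoning

module _ {G : Graph} where

  walk₀⇒≡ : ∀ {x y} → Walk G x y 0 → x ≡ y
  walk₀⇒≡ here = refl

  walk₁⇒adj : ∀ {x y} → Walk G x y 1 → Adj G x y
  walk₁⇒adj (step x~y here) = x~y

  walk₂⇒commonNeighbour : ∀ {x y} → Walk G x y 2 → ∃[ w ] (Adj G x w × Adj G w y)
  walk₂⇒commonNeighbour (step x~w (step w~y here)) = _ , x~w , w~y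

  dist≤walk : ∀ {x y d k} → Dist G x y d → Walk G x y k → d ≤ k
  dist≤walk (_ , shortest) w = ≮⇒≥ (λ k<d → shortest _ k<d w)

  noWalk<3 : ∀ {x y} → x ≢ y → ¬ Adj G x y → (∀ w → Adj G x w → ¬ Adj G w y) →
    ∀ j → j < 3 → ¬ Walk G x y j
  noWalk<3 x≢y _ _ 0 _ w = x≢y (walk₀⇒≡ w)
  noWalk<3 _ x≁y _ 1 _ w = x≁y (walk₁⇒adj w)
  noWalk<3 _ _ noCommon 2 _ w = let v , x~v , v~y = walk₂⇒commonNeighbour w in noCommon v x~v v~y
  noWalk<3 _ _ _ (suc (suc (suc _))) (s≤s (s≤s (s≤s ())))

  adj⇒dist₁ : ∀ {x y} → x ≢ y → Adj G x y → Dist G x y 1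
  adj⇒dist₁ x≢y x~y = step x~y here , λ { 0 _ w → x≢y (walk₀⇒≡ w) ; (suc _) (s≤s ()) }

  walk₂⇒dist₂ : ∀ {x y} → x ≢ y → ¬ Adj G x y → Walk G x y 2 → Dist G x y 2
  walk₂⇒dist₂ x≢y x≁y w = w , λ
    { 0 _ w₀ → x≢y (walk₀⇒≡ w₀)
    ; 1 _ w₁ → x≁y (walk₁⇒adj w₁)
    ; (suc (suc _)) (s≤s (s≤s ()))
    }

DiameterAtMost : Graph → ℕ → Set
DiameterAtMost G D = ∀ x y → ∃[ k ] (k ≤ D × Walk G x y k)

-- Every shortest y–z walk through x ends at x; in a connected graph this says
-- that no neighbour of x is farther from y than x is.
MaximallyDistantFrom : (G : Graph) → Vertex G → Vertex G → Set
MaximallyDistantFrom G y x =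
  ∀ {z a b c} → Dist G y z a → Dist G y x b → Dist G x z c → a ≡ b + c → z ≡ x

MutuallyMaximallyDistant : (G : Graph) → Vertex G → Vertex G → Set
MutuallyMaximallyDistant G x y = MaximallyDistantFrom G y x × MaximallyDistantFrom G x y

module _ {G : Graph} where

  diametral-dist : ∀ {D x y} → DiameterAtMost G D → (∀ j → j < D → ¬ Walk G x y j) →
    Dist G x y D
  diametral-dist {x = x} {y} diameter noShorter with diameter x y
  ... | k , k≤D , w with ≤∧≮⇒≡ k≤D (λ k<D → noShorter k k<D w)
  ...   | refl = w , noShorter

  diametral⇒maximallyDistant : ∀ {D x y} → DiameterAtMost G D →
    (∀ j → j < D → ¬ Walk G y x j) → MaximallyDistantFrom G y x
  diametral⇒maximallyDistant _ _ {c = zero} _ _ (here , _) _ = refl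
  diametral⇒maximallyDistant {y = y} diameter noShorter {z} {b = b} {suc c} y⇝z y⇝x _ refl
    with diameter y z
  ... | k , k≤D , y→z = contradiction b+1+c≤b (m+1+n≰m b)
    where
    b+1+c≤b : b + suc c ≤ b
    b+1+c≤b = ≤-trans (≤-trans (dist≤walk y⇝z y→z) k≤D)
                      (≮⇒≥ (λ b<D → noShorter b b<D (proj₁ y⇝x)))

  twin⇒maximallyDistant : ∀ {x y} → x ≢ y → (∀ w → Adj G x w → w ≡ y ⊎ Adj G y w) →
    MaximallyDistantFrom G y x
  twin⇒maximallyDistant _ _ {c = zero} _ _ (here , _) _ = refl
  twin⇒maximallyDistant x≢y _ {b = zero} _ (y→x , _) _ _ = contradiction (sym (walk₀⇒≡ y→x)) x≢y
  twin⇒maximallyDistant _ twin {b = suc b} {suc c} (_ , shortest) _ (step {y = w} x~w w→z , _) refl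
    with twin w x~w
  ... | inj₁ refl = ⊥-elim (shortest c (s≤s (≤-trans (n≤1+n c) (m≤n+m (suc c) b))) w→z)
  ... | inj₂ y~w = ⊥-elim (shortest (suc c) (s≤s (m≤n+m (suc c) b)) (step y~w w→z))

  mutuallyMaximallyDistant⇒resolvers : ∀ {x y z} → MutuallyMaximallyDistant G x y →
    StronglyResolves G z x y → z ≡ x ⊎ z ≡ y
  mutuallyMaximallyDistant⇒resolvers (x-far , _) (inj₁ (_ , _ , _ , y⇝z , y⇝x , x⇝z , a≡b+c)) =
    inj₁ (x-far y⇝z y⇝x x⇝z a≡b+c)
  mutuallyMaximallyDistant⇒resolvers (_ , y-far) (inj₂ (_ , _ , _ , x⇝z , x⇝y , y⇝z , a≡b+c)) =
    inj₂ (y-far x⇝z x⇝y y⇝z a≡b+c)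

  strongResolving-covers : ∀ {S x y} → StrongResolving G S → x ≢ y →
    MutuallyMaximallyDistant G x y → x ∈ S ⊎ y ∈ S
  strongResolving-covers S-resolving x≢y x⇔y with S-resolving _ _ x≢y
  ... | z , z∈S , z-resolves with mutuallyMaximallyDistant⇒resolvers x⇔y z-resolves
  ...   | inj₁ refl = inj₁ z∈S
  ...   | inj₂ refl = inj₂ z∈S

  resolves-endpointˡ : ∀ {x y d} → Dist G y x d → StronglyResolves G x x y
  resolves-endpointˡ {d = d} y⇝x =
    inj₁ (d , d , 0 , y⇝x , y⇝x , (here , λ _ ()) , sym (+-identityʳ d))

  resolves-endpointʳ : ∀ {x y d} → Dist G x y d → StronglyResolves G y x y
  resolves-endpointʳ {d = d} x⇝y =
    inj₂ (d , d , 0 , x⇝y , x⇝y , (here , λ _ ()) , sym (+-identityʳ d))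

module _ {G : Graph} (_≟_ : DecidableEquality (Vertex G)) (adj? : Decidable (Adj G))
  {vertices : List (Vertex G)} (complete : ∀ v → v ∈ vertices) where

  walk? : ∀ k x y → Dec (Walk G x y k)
  walk? zero x y = map′ (λ { refl → here }) walk₀⇒≡ (x ≟ y)
  walk? (suc k) x y = map′ viaFirst fromStep (any? (λ w → adj? x w ×-dec walk? k w y) vertices)
    where
    viaFirst : Any (λ w → Adj G x w × Walk G w y k) vertices → Walk G x y (suc k)
    viaFirst first with satisfied first
    ... | _ , x~w , w→y = step x~w w→y
    fromStep : Walk G x y (suc k) → Any (λ w → Adj G x w × Walk G w y k) vertices
    fromStep (step x~w w→y) = lose (complete _) (x~w , w→y)

  dist-exists : ∀ {x y k} → Walk G x y k → ∃ (Dist G x y)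
  dist-exists {x} {y} = least (λ j → walk? j x y)

data Link : Set where
  equal edge nonEdge : Link

data LinkOf (G : Graph) (x y : Vertex G) : Link → Set where
  equal   : x ≡ y → LinkOf G x y equal
  edge    : Adj G x y → LinkOf G x y edge
  nonEdge : x ≢ y → ¬ Adj G x y → LinkOf G x y nonEdge

record IsDecSimpleGraph (G : Graph) : Set where
  field
    _≟_        : DecidableEquality (Vertex G)
    adj?       : Decidable (Adj G)
    adj-irrefl : Irreflexive _≡_ (Adj G)
    adj-sym    : Symmetric (Adj G)

module _ {G : Graph} (G-simple : IsDecSimpleGraph G) where
  open IsDecSimpleGraph G-simple

  linkOf : ∀ x y → ∃ (LinkOf G x y)
  linkOf x y with x ≟ y | adj? x y
  ... | yes x≡y | _ = equal , equal x≡y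
  ... | no _ | yes x~y = edge , edge x~y
  ... | no x≢y | no x≁y = nonEdge , nonEdge x≢y x≁y

  link-unique : ∀ {x y r s} → LinkOf G x y r → LinkOf G x y s → r ≡ s
  link-unique (equal _) (equal _) = refl
  link-unique (edge _) (edge _) = refl
  link-unique (nonEdge _ _) (nonEdge _ _) = refl
  link-unique (equal x≡y) (edge x~y) = contradiction x~y (adj-irrefl x≡y)
  link-unique (edge x~y) (equal x≡y) = contradiction x~y (adj-irrefl x≡y)
  link-unique (equal x≡y) (nonEdge x≢y _) = contradiction x≡y x≢y
  link-unique (nonEdge x≢y _) (equal x≡y) = contradiction x≡y x≢y
  link-unique (edge x~y) (nonEdge _ x≁y) = contradiction x~y x≁y
  link-unique (nonEdge _ x≁y) (edge x~y) = contradiction x~y x≁y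

  link-sym : ∀ {x y r} → LinkOf G x y r → LinkOf G y x r
  link-sym (equal x≡y) = equal (sym x≡y)
  link-sym (edge x~y) = edge (adj-sym x~y)
  link-sym (nonEdge x≢y x≁y) = nonEdge (x≢y ∘ sym) (x≁y ∘ adj-sym)

data ModularAdj : Link → Link → Set where
  equal-edge      : ModularAdj equal edge
  edge-equal      : ModularAdj edge equal
  edge-edge       : ModularAdj edge edge
  nonEdge-nonEdge : ModularAdj nonEdge nonEdge

module ModularLinks (G H : Graph) where

  ◇-adj : ∀ {g g′ h h′ r s} → LinkOf G g g′ r → LinkOf H h h′ s → ModularAdj r s →
    Adj (G ◇ H) (g , h) (g′ , h′)
  ◇-adj (equal refl) (edge h~h′) equal-edge = inj₁ (refl , h~h′)
  ◇-adj (edge g~g′) (equal refl) edge-equal = inj₂ (inj₁ (g~g′ , refl))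
  ◇-adj (edge g~g′) (edge h~h′) edge-edge = inj₂ (inj₂ (inj₁ (g~g′ , h~h′)))
  ◇-adj (nonEdge g≢g′ g≁g′) (nonEdge h≢h′ h≁h′) nonEdge-nonEdge =
    inj₂ (inj₂ (inj₂ (g≢g′ , h≢h′ , g≁g′ , h≁h′)))

  ◇-adj⇒links : ∀ {g g′ h h′} → Adj (G ◇ H) (g , h) (g′ , h′) →
    ∃₂ λ r s → LinkOf G g g′ r × LinkOf H h h′ s × ModularAdj r s
  ◇-adj⇒links (inj₁ (refl , h~h′)) = _ , _ , equal refl , edge h~h′ , equal-edge
  ◇-adj⇒links (inj₂ (inj₁ (g~g′ , refl))) = _ , _ , edge g~g′ , equal refl , edge-equal
  ◇-adj⇒links (inj₂ (inj₂ (inj₁ (g~g′ , h~h′)))) = _ , _ , edge g~g′ , edge h~h′ , edge-edge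
  ◇-adj⇒links (inj₂ (inj₂ (inj₂ (g≢g′ , h≢h′ , g≁g′ , h≁h′)))) =
    _ , _ , nonEdge g≢g′ g≁g′ , nonEdge h≢h′ h≁h′ , nonEdge-nonEdge

-- The possible links of a vertex to the two ends of a removed matching edge of K_{n,n}^{-M}.
data Partnered : Link → Link → Set where
  equal-nonEdge : Partnered equal nonEdge
  nonEdge-equal : Partnered nonEdge equal
  edge-nonEdge  : Partnered edge nonEdge
  nonEdge-edge  : Partnered nonEdge edge

partnered-swap : ∀ {r r̄} → Partnered r r̄ → Partnered r̄ r
partnered-swap equal-nonEdge = nonEdge-equal
partnered-swap nonEdge-equal = equal-nonEdge
partnered-swap edge-nonEdge = nonEdge-edge
partnered-swap nonEdge-edge = edge-nonEdge

partnered-noCommonˡ : ∀ {r r̄ s} → Partnered r r̄ → ModularAdj r s → ¬ ModularAdj r̄ s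
partnered-noCommonˡ equal-nonEdge equal-edge ()
partnered-noCommonˡ nonEdge-equal nonEdge-nonEdge ()
partnered-noCommonˡ edge-nonEdge edge-equal ()
partnered-noCommonˡ edge-nonEdge edge-edge ()
partnered-noCommonˡ nonEdge-edge nonEdge-nonEdge ()

partnered-noCommonʳ : ∀ {r s s̄} → Partnered s s̄ → ModularAdj r s → ¬ ModularAdj r s̄
partnered-noCommonʳ equal-nonEdge edge-equal ()
partnered-noCommonʳ nonEdge-equal nonEdge-nonEdge ()
partnered-noCommonʳ edge-nonEdge equal-edge ()
partnered-noCommonʳ edge-nonEdge edge-edge ()
partnered-noCommonʳ nonEdge-edge nonEdge-nonEdge ()

partnered-twin : ∀ {r r̄ s s̄} → Partnered r r̄ → Partnered s s̄ → ModularAdj r s →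
  ModularAdj r̄ s̄ ⊎ (r̄ ≡ equal × s̄ ≡ equal)
partnered-twin equal-nonEdge edge-nonEdge equal-edge = inj₁ nonEdge-nonEdge
partnered-twin edge-nonEdge equal-nonEdge edge-equal = inj₁ nonEdge-nonEdge
partnered-twin edge-nonEdge edge-nonEdge edge-edge = inj₁ nonEdge-nonEdge
partnered-twin nonEdge-equal nonEdge-equal nonEdge-nonEdge = inj₂ (refl , refl)
partnered-twin nonEdge-equal nonEdge-edge nonEdge-nonEdge = inj₁ equal-edge
partnered-twin nonEdge-edge nonEdge-equal nonEdge-nonEdge = inj₁ edge-equal
partnered-twin nonEdge-edge nonEdge-edge nonEdge-nonEdge = inj₁ edge-edge

Partners : (G : Graph) → Vertex G → Vertex G → Set
Partners G p p̄ = ∀ q → ∃₂ λ r r̄ → LinkOf G p q r × LinkOf G p̄ q r̄ × Partnered r r̄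

partners-sym : ∀ {G p p̄} → Partners G p p̄ → Partners G p̄ p
partners-sym p⇔p̄ q with p⇔p̄ q
... | r , r̄ , p-q , p̄-q , partnered = r̄ , r , p̄-q , p-q , partnered-swap partnered

partners-apart : ∀ {G} → IsDecSimpleGraph G → ∀ {p p̄} → Partners G p p̄ → LinkOf G p p̄ nonEdge
partners-apart G-simple {p̄ = p̄} p⇔p̄ with p⇔p̄ p̄
... | _ , _ , p-p̄ , equal _ , nonEdge-equal = p-p̄
... | _ , _ , _ , edge p̄~p̄ , _ = contradiction p̄~p̄ (IsDecSimpleGraph.adj-irrefl G-simple refl)
... | _ , _ , _ , nonEdge p̄≢p̄ _ , _ = contradiction refl p̄≢p̄

module ModularProduct {G H : Graph} (G-simple : IsDecSimpleGraph G) (H-simple : IsDecSimpleGraph H)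
  where
  open IsDecSimpleGraph G-simple using () renaming (_≟_ to _≟G_; adj? to adjG?)
  open IsDecSimpleGraph H-simple using () renaming (_≟_ to _≟H_; adj? to adjH?)
  open ModularLinks G H public

  ◇-≟ : DecidableEquality (Vertex (G ◇ H))
  ◇-≟ = ≡-dec _≟G_ _≟H_

  ◇-adj? : Decidable (Adj (G ◇ H))
  ◇-adj? (g , h) (g′ , h′) =
    (g ≟G g′ ×-dec adjH? h h′) ⊎-dec (adjG? g g′ ×-dec h ≟H h′)
    ⊎-dec (adjG? g g′ ×-dec adjH? h h′)
    ⊎-dec (¬? (g ≟G g′) ×-dec ¬? (h ≟H h′) ×-dec ¬? (adjG? g g′) ×-dec ¬? (adjH? h h′))

  ◇-adj⁻¹ : ∀ {g g′ h h′ r s} → LinkOf G g g′ r → LinkOf H h h′ s →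
    Adj (G ◇ H) (g , h) (g′ , h′) → ModularAdj r s
  ◇-adj⁻¹ g-g′ h-h′ adj with ◇-adj⇒links adj
  ... | _ , _ , g-g″ , h-h″ , modular =
    subst₂ ModularAdj (link-unique G-simple g-g″ g-g′) (link-unique H-simple h-h″ h-h′) modular

  ◇-nonadj : ∀ {g g′ h h′ r s} → LinkOf G g g′ r → LinkOf H h h′ s → ¬ ModularAdj r s →
    ¬ Adj (G ◇ H) (g , h) (g′ , h′)
  ◇-nonadj g-g′ h-h′ ¬modular = ¬modular ∘ ◇-adj⁻¹ g-g′ h-h′

  ◇-partners-noCommonNeighbourˡ : ∀ {p p̄} → Partners G p p̄ → ∀ h w →
    Adj (G ◇ H) (p , h) w → ¬ Adj (G ◇ H) w (p̄ , h)
  ◇-partners-noCommonNeighbourˡ p⇔p̄ h (g , h′) x~w w~y with p⇔p̄ g | linkOf H-simple h h′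
  ... | _ , _ , p-g , p̄-g , partnered | _ , h-h′ =
    partnered-noCommonˡ partnered (◇-adj⁻¹ p-g h-h′ x~w)
      (◇-adj⁻¹ (link-sym G-simple p̄-g) (link-sym H-simple h-h′) w~y)

  ◇-partners-noCommonNeighbourʳ : ∀ {q q̄} → Partners H q q̄ → ∀ g w →
    Adj (G ◇ H) (g , q) w → ¬ Adj (G ◇ H) w (g , q̄)
  ◇-partners-noCommonNeighbourʳ q⇔q̄ g (g′ , h) x~w w~y with linkOf G-simple g g′ | q⇔q̄ h
  ... | _ , g-g′ | _ , _ , q-h , q̄-h , partnered =
    partnered-noCommonʳ partnered (◇-adj⁻¹ g-g′ q-h x~w)
      (◇-adj⁻¹ (link-sym G-simple g-g′) (link-sym H-simple q̄-h) w~y)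

  ◇-partners-farˡ : ∀ {p p̄} → Partners G p p̄ → ∀ h j → j < 3 → ¬ Walk (G ◇ H) (p , h) (p̄ , h) j
  ◇-partners-farˡ p⇔p̄ h with partners-apart G-simple p⇔p̄
  ... | p-p̄@(nonEdge p≢p̄ _) =
    noWalk<3 (p≢p̄ ∘ cong proj₁) (◇-nonadj p-p̄ (equal refl) λ ())
      (◇-partners-noCommonNeighbourˡ p⇔p̄ h)

  ◇-partners-farʳ : ∀ {q q̄} → Partners H q q̄ → ∀ g j → j < 3 → ¬ Walk (G ◇ H) (g , q) (g , q̄) j
  ◇-partners-farʳ q⇔q̄ g with partners-apart H-simple q⇔q̄
  ... | q-q̄@(nonEdge q≢q̄ _) =
    noWalk<3 (q≢q̄ ∘ cong proj₂) (◇-nonadj (equal refl) q-q̄ λ ())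
      (◇-partners-noCommonNeighbourʳ q⇔q̄ g)

  ◇-partners-twins : ∀ {p p̄ q q̄} → Partners G p p̄ → Partners H q q̄ →
    ∀ w → Adj (G ◇ H) (p , q) w → w ≡ (p̄ , q̄) ⊎ Adj (G ◇ H) (p̄ , q̄) w
  ◇-partners-twins p⇔p̄ q⇔q̄ (g , h) x~w with p⇔p̄ g | q⇔q̄ h
  ... | _ , _ , p-g , p̄-g , partneredG | _ , _ , q-h , q̄-h , partneredH
    with partnered-twin partneredG partneredH (◇-adj⁻¹ p-g q-h x~w) | p̄-g | q̄-h
  ...   | inj₁ modular | _ | _ = inj₂ (◇-adj p̄-g q̄-h modular)
  ...   | inj₂ (refl , refl) | equal refl | equal refl = inj₁ refl

sameOrFlipped : ∀ a b → b ≡ a ⊎ b ≡ not a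
sameOrFlipped false false = inj₁ refl
sameOrFlipped false true = inj₂ refl
sameOrFlipped true false = inj₂ refl
sameOrFlipped true true = inj₁ refl

avoid : ∀ {k} → 3 ≤ k → (i i′ : Fin k) → ∃[ c ] (c ≢ i × c ≢ i′)
avoid (s≤s (s≤s (s≤s _))) i i′ with zero ≟ᶠ i | zero ≟ᶠ i′
... | no 0≢i | no 0≢i′ = zero , 0≢i , 0≢i′
... | yes refl | _ with suc zero ≟ᶠ i′
...   | no 1≢i′ = suc zero , (λ ()) , 1≢i′
...   | yes refl = suc (suc zero) , (λ ()) , (λ ())
avoid (s≤s (s≤s (s≤s _))) i i′ | no _ | yes refl with suc zero ≟ᶠ i
...   | no 1≢i = suc zero , 1≢i , (λ ())
...   | yes refl = suc (suc zero) , (λ ()) , (λ ())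

module _ {k : ℕ} where

  K-simple : IsDecSimpleGraph (KnnMinusM k)
  K-simple = record
    { _≟_ = ≡-dec _≟ᶠ_ _≟ᵇ_
    ; adj? = λ (i , a) (j , b) → ¬? (a ≟ᵇ b) ×-dec ¬? (i ≟ᶠ j)
    ; adj-irrefl = λ { refl (a≢a , _) → a≢a refl }
    ; adj-sym = λ (a≢b , i≢j) → a≢b ∘ sym , i≢j ∘ sym
    }

  K-vertices : List (Fin k × Bool)
  K-vertices = cartesianProduct (allFin k) (false ∷ true ∷ [])

  ∈-K-vertices : ∀ v → v ∈ K-vertices
  ∈-K-vertices (i , false) = ∈-cartesianProduct⁺ (∈-allFin i) (here refl)
  ∈-K-vertices (i , true) = ∈-cartesianProduct⁺ (∈-allFin i) (there (here refl))

  sameSide : ∀ {i j a} → i ≢ j → LinkOf (KnnMinusM k) (i , a) (j , a) nonEdge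
  sameSide i≢j = nonEdge (i≢j ∘ cong proj₁) (λ (a≢a , _) → a≢a refl)

  crossSide : ∀ {i j a} → i ≢ j → LinkOf (KnnMinusM k) (i , a) (j , not a) edge
  crossSide i≢j = edge (not-¬ refl , i≢j)

  matched : ∀ {i a} → LinkOf (KnnMinusM k) (i , a) (i , not a) nonEdge
  matched = nonEdge (not-¬ refl ∘ cong proj₂) (λ (_ , i≢i) → i≢i refl)

  K-partners : ∀ i a → Partners (KnnMinusM k) (i , a) (i , not a)
  K-partners i a (j , c) with i ≟ᶠ j | sameOrFlipped a c
  ... | yes refl | inj₁ refl = _ , _ , equal refl , link-sym K-simple matched , equal-nonEdge
  ... | yes refl | inj₂ refl = _ , _ , matched , equal refl , nonEdge-equal
  ... | no i≢j | inj₁ refl = _ , _ , sameSide i≢j , edge (not-¬ refl ∘ sym , i≢j) , nonEdge-edge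
  ... | no i≢j | inj₂ refl = _ , _ , crossSide i≢j , sameSide i≢j , edge-nonEdge

module KnnMinusMProduct {n m : ℕ} (3≤n : 3 ≤ n) (3≤m : 3 ≤ m) where

  P : Graph
  P = KnnMinusM n ◇ KnnMinusM m

  open ModularProduct (K-simple {n}) (K-simple {m})

  parallel-step : ∀ {i i′ j j′ a b} → i ≢ i′ → j ≢ j′ →
    Adj P ((i , a) , (j , b)) ((i′ , a) , (j′ , b))
  parallel-step i≢i′ j≢j′ = ◇-adj (sameSide i≢i′) (sameSide j≢j′) nonEdge-nonEdge

  crossed-step : ∀ {i i′ j j′ a b} → i ≢ i′ → j ≢ j′ →
    Adj P ((i , a) , (j , b)) ((i′ , not a) , (j′ , not b))
  crossed-step i≢i′ j≢j′ = ◇-adj (crossSide i≢i′) (crossSide j≢j′) edge-edge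

  walk₂-via : ∀ i j i′ j′ {a b v} → (∀ {k l} → k ≢ i′ → l ≢ j′ → Adj P ((k , a) , (l , b)) v) →
    Walk P ((i , a) , (j , b)) v 2
  walk₂-via i j i′ j′ last-step with avoid 3≤n i i′ | avoid 3≤m j j′
  ... | k , k≢i , k≢i′ | l , l≢j , l≢j′ =
    step (parallel-step (k≢i ∘ sym) (l≢j ∘ sym)) (step (last-step k≢i′ l≢j′) here)

  diameter : DiameterAtMost P 3
  diameter ((i , a) , (j , b)) ((i′ , a′) , (j′ , b′)) with sameOrFlipped a a′ | sameOrFlipped b b′
  ... | inj₁ refl | inj₁ refl = 2 , n≤1+n 2 , walk₂-via i j i′ j′ parallel-step
  ... | inj₂ refl | inj₂ refl = 2 , n≤1+n 2 , walk₂-via i j i′ j′ crossed-step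
  ... | inj₁ refl | inj₂ refl with avoid 3≤m j j
  ...   | l , l≢j , _ = 3 , ≤-refl ,
    step (◇-adj (equal refl) (crossSide (l≢j ∘ sym)) equal-edge) (walk₂-via i l i′ j′ parallel-step)
  diameter ((i , a) , (j , b)) ((i′ , a′) , (j′ , b′)) | inj₂ refl | inj₁ refl with avoid 3≤n i i
  ...   | k , k≢i , _ = 3 , ≤-refl ,
    step (◇-adj (crossSide (k≢i ∘ sym)) (equal refl) edge-equal) (walk₂-via k j i′ j′ parallel-step)

  dist : ∀ u v → ∃ (Dist P u v)
  dist u v = dist-exists ◇-≟ ◇-adj? ∈-P-vertices (proj₂ (proj₂ (diameter u v)))
    where
    ∈-P-vertices : ∀ v → v ∈ cartesianProduct K-vertices K-vertices
    ∈-P-vertices (g , h) = ∈-cartesianProduct⁺ (∈-K-vertices g) (∈-K-vertices h)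

  farˡ-dist : ∀ i a h → Dist P ((i , a) , h) ((i , not a) , h) 3
  farˡ-dist i a h = diametral-dist diameter (◇-partners-farˡ (K-partners i a) h)

  farˡ-mutuallyMaximallyDistant : ∀ i a h →
    MutuallyMaximallyDistant P ((i , a) , h) ((i , not a) , h)
  farˡ-mutuallyMaximallyDistant i a h =
    diametral⇒maximallyDistant diameter (◇-partners-farˡ (partners-sym (K-partners i a)) h) ,
    diametral⇒maximallyDistant diameter (◇-partners-farˡ (K-partners i a) h)

  farʳ-mutuallyMaximallyDistant : ∀ g j b →
    MutuallyMaximallyDistant P (g , (j , b)) (g , (j , not b))
  farʳ-mutuallyMaximallyDistant g j b =
    diametral⇒maximallyDistant diameter (◇-partners-farʳ (partners-sym (K-partners j b)) g) ,
    diametral⇒maximallyDistant diameter (◇-partners-farʳ (K-partners j b) g)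

  twin-mutuallyMaximallyDistant : ∀ i a j b →
    MutuallyMaximallyDistant P ((i , a) , (j , b)) ((i , not a) , (j , not b))
  twin-mutuallyMaximallyDistant i a j b =
    twin⇒maximallyDistant x≢y (◇-partners-twins (K-partners i a) (K-partners j b)) ,
    twin⇒maximallyDistant (x≢y ∘ sym)
      (◇-partners-twins (partners-sym (K-partners i a)) (partners-sym (K-partners j b)))
    where
    x≢y : ((i , a) , (j , b)) ≢ ((i , not a) , (j , not b))
    x≢y = not-¬ refl ∘ cong (proj₂ ∘ proj₁)

  unmarked : Fin n → Fin m → Vertex P
  unmarked i j = (i , false) , (j , false)

  landmarks : Fin n × Fin m → List (Vertex P)
  landmarks (i , j) =
    ((i , false) , (j , true)) ∷ ((i , true) , (j , false)) ∷ ((i , true) , (j , true)) ∷ []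

  block : Fin n × Fin m → List (Vertex P)
  block (i , j) = unmarked i j ∷ landmarks (i , j)

  blockOf : Vertex P → Fin n × Fin m
  blockOf ((i , _) , (j , _)) = i , j

  ∈-block⇒blockOf : ∀ {ij v} → v ∈ block ij → blockOf v ≡ ij
  ∈-block⇒blockOf (here refl) = refl
  ∈-block⇒blockOf (there (here refl)) = refl
  ∈-block⇒blockOf (there (there (here refl))) = refl
  ∈-block⇒blockOf (there (there (there (here refl)))) = refl

  block-unique : ∀ ij → Unique (block ij)
  block-unique _ =
    ((λ ()) ∷ (λ ()) ∷ (λ ()) ∷ []) ∷ ((λ ()) ∷ (λ ()) ∷ []) ∷ ((λ ()) ∷ []) ∷ [] ∷ []

  block-mutuallyMaximallyDistant : ∀ ij → AllPairs (MutuallyMaximallyDistant P) (block ij)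
  block-mutuallyMaximallyDistant (i , j) =
    (farʳ-mutuallyMaximallyDistant (i , false) j false ∷
     farˡ-mutuallyMaximallyDistant i false (j , false) ∷
     twin-mutuallyMaximallyDistant i false j false ∷ []) ∷
    (twin-mutuallyMaximallyDistant i false j true ∷
     farˡ-mutuallyMaximallyDistant i false (j , true) ∷ []) ∷
    (farʳ-mutuallyMaximallyDistant (i , true) j false ∷ []) ∷ [] ∷ []

  blocks : List (Fin n × Fin m)
  blocks = cartesianProduct (allFin n) (allFin m)

  blocks-unique : Unique blocks
  blocks-unique = cartesianProduct⁺ (allFin⁺ n) (allFin⁺ m)

  length-blocks*3 : length blocks * 3 ≡ 3 * n * m
  length-blocks*3 = begin
    length blocks * 3
      ≡⟨ cong (_* 3) (length-cartesianProduct (allFin n) (allFin m)) ⟩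
    length (allFin n) * length (allFin m) * 3
      ≡⟨ cong₂ (λ a b → a * b * 3) (length-tabulate {n = n} id) (length-tabulate {n = m} id) ⟩
    n * m * 3
      ≡⟨ *-comm (n * m) 3 ⟩
    3 * (n * m)
      ≡⟨ *-assoc 3 n m ⟨
    3 * n * m
      ∎
    where open ≡-Reasoning

  lower-bound : ∀ S → Unique S → StrongResolving P S → 3 * n * m ≤ length S
  lower-bound S S-unique S-resolving = begin
    3 * n * m                           ≡⟨ length-blocks*3 ⟨
    length blocks * 3                   ≤⟨ length-concatMap-≥ resolvers blocks three-resolvers ⟩
    length (concatMap resolvers blocks) ≤⟨ Unique⇒length≤ resolvers-unique resolvers⊆S ⟩
    length S                            ∎
    where
    open ≤-Reasoning
    open import Data.List.Membership.DecPropositional ◇-≟ using (_∈?_)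
    resolvers : Fin n × Fin m → List (Vertex P)
    resolvers ij = filter (_∈? S) (block ij)
    three-resolvers : ∀ ij → 3 ≤ length (resolvers ij)
    three-resolvers ij = s≤s⁻¹ (length-filter-pairwiseCover (_∈? S)
      (AllPairs.zipWith (λ (x≢y , x⇔y) → strongResolving-covers S-resolving x≢y x⇔y)
        (block-unique ij , block-mutuallyMaximallyDistant ij)))
    resolvers-unique : Unique (concatMap resolvers blocks)
    resolvers-unique = unique-concatMap blockOf blocks-unique
      (filter⁺ (_∈? S) ∘ block-unique) (∈-block⇒blockOf ∘ proj₁ ∘ ∈-filter⁻ (_∈? S))
    resolvers⊆S : concatMap resolvers blocks ⊆ S
    resolvers⊆S v∈ with find (∈-concatMap⁻ resolvers {xs = blocks} v∈)
    ... | ij , _ , v∈resolvers = proj₂ (∈-filter⁻ (_∈? S) {xs = block ij} v∈resolvers)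

  landmarkSet : List (Vertex P)
  landmarkSet = concatMap landmarks blocks

  landmarkSet-unique : Unique landmarkSet
  landmarkSet-unique =
    unique-concatMap blockOf blocks-unique (AllPairs.tail ∘ block-unique) (∈-block⇒blockOf ∘ there)

  landmarkSet-length : length landmarkSet ≡ 3 * n * m
  landmarkSet-length = trans (length-concatMap-≡ landmarks blocks (λ _ → refl)) length-blocks*3

  ∈-landmarkSet : ∀ {i j v} → v ∈ landmarks (i , j) → v ∈ landmarkSet
  ∈-landmarkSet {i} {j} v∈ =
    ∈-concatMap⁺ landmarks (lose (∈-cartesianProduct⁺ (∈-allFin i) (∈-allFin j)) v∈)

  landmark-or-unmarked : ∀ v → v ∈ landmarkSet ⊎ ∃₂ λ i j → v ≡ unmarked i j
  landmark-or-unmarked ((i , false) , (j , false)) = inj₂ (i , j , refl)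
  landmark-or-unmarked ((i , false) , (j , true)) = inj₁ (∈-landmarkSet (here refl))
  landmark-or-unmarked ((i , true) , (j , false)) = inj₁ (∈-landmarkSet (there (here refl)))
  landmark-or-unmarked ((i , true) , (j , true)) = inj₁ (∈-landmarkSet (there (there (here refl))))

  -- In each case x lies on a shortest walk from y to the chosen landmark z.
  unmarked-resolved : ∀ {i j i′ j′} → unmarked i j ≢ unmarked i′ j′ →
    ∃[ z ] (z ∈ landmarkSet × StronglyResolves P z (unmarked i j) (unmarked i′ j′))
  unmarked-resolved {i} {j} {i′} {j′} x≢y with i ≟ᶠ i′ | j ≟ᶠ j′
  ... | yes refl | yes refl = contradiction refl x≢y
  ... | yes refl | no j≢j′ =
    ((i , true) , (j′ , false)) , ∈-landmarkSet (there (here refl)) ,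
    inj₁ (3 , 2 , 1 , farˡ-dist i false (j′ , false) ,
          walk₂⇒dist₂ (x≢y ∘ sym) (◇-nonadj (equal refl) (sameSide (j≢j′ ∘ sym)) λ ())
            (walk₂-via i j′ i j parallel-step) ,
          adj⇒dist₁ (λ ()) (◇-adj matched (sameSide j≢j′) nonEdge-nonEdge) , refl)
  ... | no i≢i′ | yes refl =
    ((i′ , true) , (j , false)) , ∈-landmarkSet (there (here refl)) ,
    inj₁ (3 , 2 , 1 , farˡ-dist i′ false (j , false) ,
          walk₂⇒dist₂ (x≢y ∘ sym) (◇-nonadj (sameSide (i≢i′ ∘ sym)) (equal refl) λ ())
            (walk₂-via i′ j i j parallel-step) ,
          adj⇒dist₁ (λ ()) (◇-adj (crossSide i≢i′) (equal refl) edge-equal) , refl)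
  ... | no i≢i′ | no j≢j′ with avoid 3≤m j j′
  ...   | l , l≢j , l≢j′ =
    ((i , false) , (l , true)) , ∈-landmarkSet (here refl) ,
    inj₁ (2 , 1 , 1 ,
          walk₂⇒dist₂ (λ ()) (◇-nonadj (sameSide (i≢i′ ∘ sym)) (crossSide (l≢j′ ∘ sym)) λ ())
            (step y~x (step x~z here)) ,
          adj⇒dist₁ (x≢y ∘ sym) y~x , adj⇒dist₁ (λ ()) x~z , refl)
    where
    y~x : Adj P (unmarked i′ j′) (unmarked i j)
    y~x = parallel-step (i≢i′ ∘ sym) (j≢j′ ∘ sym)
    x~z : Adj P (unmarked i j) ((i , false) , (l , true))
    x~z = ◇-adj (equal refl) (crossSide (l≢j ∘ sym)) equal-edge

  landmarkSet-resolving : StrongResolving P landmarkSet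
  landmarkSet-resolving x y x≢y with landmark-or-unmarked x | landmark-or-unmarked y
  ... | inj₁ x∈ | _ = x , x∈ , resolves-endpointˡ (proj₂ (dist y x))
  ... | inj₂ _ | inj₁ y∈ = y , y∈ , resolves-endpointʳ (proj₂ (dist x y))
  ... | inj₂ (_ , _ , refl) | inj₂ (_ , _ , refl) = unmarked-resolved x≢y

corollary4p12 : (n m : ℕ) → 3 ≤ n → 3 ≤ m →
    StrongMetricDim (KnnMinusM n ◇ KnnMinusM m) (3 * n * m)
corollary4p12 n m 3≤n 3≤m =
  (landmarkSet , landmarkSet-unique , landmarkSet-length , landmarkSet-resolving) , lower-bound
  where open KnnMinusMProduct 3≤n 3≤m
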